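{- Let $\mathsf N\subset\mathcal T$ be a finite order ideal of terms in $\mathbf k[x_1,\dots,x_n]$ and let $I$ be the monomial ideal with $\mathsf N(I)=\mathsf N$. Then the star set $\mathcal F_{\mathsf N}$ of $\mathsf N$ (defined via its Bar Code) equals $\mathcal F(I)=\{x^\gamma\in\mathcal T\setminus\mathsf N(I) : x^\gamma/\min(x^\gamma)\in\mathsf N(I)\}$.
   Context: $\mathcal T$ is the set of terms (monic monomials) of $\mathbf k[x_1,\dots,x_n]$, with $x_1<x_2<\dots<x_n$ and the lexicographic order: $x^\gamma<x^\delta$ iff there is $j$ with $\gamma_j<\delta_j$ and $\gamma_i=\delta_i$ for all $i>j$. For $\tau=x_1^{\gamma_1}\cdots x_n^{\gamma_n}$ put $P_{x_i}(\tau)=x_i^{\gamma_i}\cdots x_n^{\gamma_n}$; $\min(\tau)$ is the smallest variable dividing $\tau$. An order ideal is a set of terms closed under divisors; for a monomial ideal $I$, $\mathsf N(I)$ is the set of terms not in $I$. Bar Code of a finite set $M=\{\tau_1<\dots<\tau_m\}$ (lex): for each $i=1,\dots,n$, the $i$-th row is the sequence $P_{x_i}(\tau_1),\dots,P_{x_i}(\tau_m)$; each maximal run of consecutive equal entries, viewed as an interval of column indices, is an $i$-bar; $B^{(i)}_1,\dots,B^{(i)}_{\mu(i)}$ are the $i$-bars from left to right. A bar of row $i'<i$ lies over a bar of row $i$ if it is contained in it (as a set of columns); the term $\tau_c$ labels the $1$-bar $\{c\}$. Star set $\mathcal F_{\mathsf N}$: (a) for each $1\le i\le n$, if $\tau$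 labels a $1$-bar lying over $B^{(i)}_{\mu(i)}$, then $x_iP_{x_i}(\tau)\in\mathcal F_{\mathsf N}$; (b) for each $1\le i\le n-1$ and $1\le j\le\mu(i)-1$ such that $B^{(i)}_j$ and $B^{(i)}_{j+1}$ do not lie over the same $(i+1)$-bar, if $\tau$ labels a $1$-bar lying over $B^{(i)}_j$, then $x_iP_{x_i}(\tau)\in\mathcal F_{\mathsf N}$; $\mathcal F_{\mathsf N}$ consists exactly of the terms so obtained. -}

module Defs where

open import Data.Nat using (ℕ; zero; suc; _≤_; _<_; _∸_; _<ᵇ_)
open import Data.Fin using (Fin; toℕ)
open import Data.Vec using (Vec; lookup; tabulate; updateAt; replicate)
open import Data.List using (List; length)
import Data.List as List
open import Data.List.Membership.Propositional using (_∈_; _∉_)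
open import Data.List.Relation.Unary.Linked using (Linked)
open import Data.Product using (Σ; ∃; _×_)
open import Data.Sum using (_⊎_)
open import Data.Bool using (if_then_else_)
open import Relation.Binary.PropositionalEquality using (_≡_; _≢_)
open import Relation.Nullary using (¬_)

-- A term x_1^{γ_1} ⋯ x_n^{γ_n} is its exponent vector; variable x_{k+1} ↔ index k : Fin n.
Term : ℕ → Set
Term n = Vec ℕ n

one : ∀ {n} → Term n
one = replicate _ 0

_∣ₜ_ : ∀ {n} → Term n → Term n → Set
σ ∣ₜ τ = ∀ k → lookup σ k ≤ lookup τ k

-- lexicographic order with x_1 < ⋯ < x_n (last variable most significant)
_<lex_ : ∀ {n} → Term n → Term n → Set
γ <lex δ = ∃ λ j → (lookup γ j < lookup δ j) × (∀ i → toℕ j < toℕ i → lookup γ i ≡ lookup δ i)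

IsOrderIdeal : ∀ {n} → List (Term n) → Set
IsOrderIdeal L = ∀ τ σ → σ ∣ₜ τ → τ ∈ L → σ ∈ L

P : ∀ {n} → Fin n → Term n → Term n
P i τ = tabulate (λ k → if toℕ k <ᵇ toℕ i then 0 else lookup τ k)

mulVar : ∀ {n} → Fin n → Term n → Term n
mulVar i τ = updateAt τ i suc

-- division by the variable x_i (used only when x_i ∣ τ)
divVar : ∀ {n} → Fin n → Term n → Term n
divVar i τ = updateAt τ i (λ e → e ∸ 1)

module BarCode {n : ℕ} (L : List (Term n)) where
  -- columns 1..m are indexed by Fin m; column c carries τ_c = L[c]
  m : ℕ
  m = length L

  τ : Fin m → Term n
  τ c = List.lookup L c

  row : Fin n → Fin m → Term n
  row i c = P i (τ c)

  -- the interval of columns [a, b] is an i-bar: a maximal run of equal consecutive entries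
  IsBar : Fin n → Fin m → Fin m → Set
  IsBar i a b =
    (toℕ a ≤ toℕ b) ×
    (∀ c → toℕ a ≤ toℕ c → toℕ c ≤ toℕ b → row i c ≡ row i a) ×
    (∀ c → suc (toℕ c) ≡ toℕ a → row i c ≢ row i a) ×
    (∀ c → toℕ c ≡ suc (toℕ b) → row i c ≢ row i b)

  -- column c (i.e. the 1-bar {c}, labelled τ_c) lies over the interval [a, b]
  InInterval : Fin m → Fin m → Fin m → Set
  InInterval c a b = (toℕ a ≤ toℕ c) × (toℕ c ≤ toℕ b)

  RuleA : Term n → Set
  RuleA σ = ∃ λ (i : Fin n) → ∃ λ (a : Fin m) → ∃ λ (b : Fin m) → ∃ λ (c : Fin m) →
    IsBar i a b × (suc (toℕ b) ≡ m) × InInterval c a b × (σ ≡ mulVar i (P i (τ c)))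

  RuleB : Term n → Set
  RuleB σ = ∃ λ (i : Fin n) → ∃ λ (i' : Fin n) → (toℕ i' ≡ suc (toℕ i)) ×
    ∃ λ (a : Fin m) → ∃ λ (b : Fin m) → ∃ λ (b' : Fin m) → ∃ λ (e : Fin m) →
    IsBar i a b × IsBar i b' e × (toℕ b' ≡ suc (toℕ b)) ×
    (¬ (∃ λ (a₂ : Fin m) → ∃ λ (b₂ : Fin m) →
          IsBar i' a₂ b₂ × InInterval a a₂ b₂ × InInterval e a₂ b₂)) ×
    ∃ λ (c : Fin m) → InInterval c a b × (σ ≡ mulVar i (P i (τ c)))

  StarSet : Term n → Set
  StarSet σ = RuleA σ ⊎ RuleB σ

IsMinVar : ∀ {n} → Term n → Fin n → Set
IsMinVar σ k = (1 ≤ lookup σ k) × (∀ j → toℕ j < toℕ k → lookup σ j ≡ 0)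

CornerSet : ∀ {n} → List (Term n) → Term n → Set
CornerSet L σ = (σ ∉ L) × ∃ λ k → IsMinVar σ k × (divVar k σ ∈ L)

module Submission where

-- Both sets consist of terms σ = x_i P_{x_i}(τ) with τ ∈ N and min(σ) = x_i: in F(I) take τ = σ / min(σ),
-- and both bar-code rules produce terms of this shape. Let τ = τ_c lie in the i-bar [a, b] and let e be the
-- last column of the following i-bar. Since the columns are lex-sorted, a column holding σ lies beyond b and
-- agrees with τ_c from x_{i+1} on, and then so does τ_e; conversely, if τ_c and τ_e agree from x_{i+1} on,
-- then σ divides τ_e. So σ ∉ N exactly when [a, b] is the last i-bar (rule (a)) or τ_c and τ_e differ
-- beyond x_i, which is rule (b): columns a and e share an (i+1)-bar iff τ_a and τ_e agree from x_{i+1} on.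

open import Defs
open import Data.Bool using (true; false; if_then_else_)
open import Data.Fin as Fin using (Fin; toℕ; fromℕ<)
open import Data.Fin.Properties using (toℕ-injective; toℕ<n; toℕ-fromℕ<)
import Data.Fin.Properties as Finₚ
open import Data.List using (List; _∷_)
import Data.List as List
open import Data.List.Membership.Propositional using (_∈_; _∉_)
open import Data.List.Membership.Propositional.Properties using (∈-lookup)
open import Data.List.Relation.Unary.Any using (index)
open import Data.List.Relation.Unary.Any.Properties using (lookup-index)
open import Data.List.Relation.Unary.Linked as Linked using (Linked)
open import Data.Nat using (ℕ; zero; suc; pred; _≤_; _<_; _∸_; _<ᵇ_; z≤n; s≤s; s≤s⁻¹)
open import Data.Nat.Properties
open import Data.Product using (∃; ∃₂; _×_; _,_; proj₁)
open import Data.Sum using (inj₁; inj₂)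
open import Data.Vec using (lookup)
open import Data.Vec.Properties using (lookup∘tabulate; lookup∘updateAt; lookup∘updateAt′; ≡-dec)
open import Data.Vec.Relation.Binary.Pointwise.Extensional using (ext; Pointwise-≡⇒≡)
open import Relation.Binary.Core using (Rel)
open import Relation.Binary.Definitions using (Transitive; DecidableEquality; tri<; tri≈; tri>)
open import Relation.Binary.PropositionalEquality
open import Function using (_∘_)
open import Relation.Nullary using (¬_; Dec; yes; no; contradiction)
open import Relation.Nullary.Reflects using (ofʸ; ofⁿ)

private variable
  n : ℕ
  k l : ℕ
  i j : Fin n
  γ δ ε σ : Term n

-- AgreeFrom (toℕ i) γ δ is P i γ ≡ P i δ read pointwise; a record, so that γ and δ are inferable.
record AgreeFrom (k : ℕ) (γ δ : Term n) : Set where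
  constructor agreeFrom
  field agreeAt : ∀ j → k ≤ toℕ j → lookup γ j ≡ lookup δ j
open AgreeFrom

agree-sym : AgreeFrom k γ δ → AgreeFrom k δ γ
agree-sym (agreeFrom ag) = agreeFrom λ j k≤j → sym (ag j k≤j)

agree-trans : AgreeFrom k γ δ → AgreeFrom k δ ε → AgreeFrom k γ ε
agree-trans (agreeFrom ag) (agreeFrom ag′) = agreeFrom λ j k≤j → trans (ag j k≤j) (ag′ j k≤j)

agree-weaken : k ≤ l → AgreeFrom k γ δ → AgreeFrom l γ δ
agree-weaken k≤l (agreeFrom ag) = agreeFrom λ j l≤j → ag j (≤-trans k≤l l≤j)

lookup-P : (i j : Fin n) (γ : Term n) → lookup (P i γ) j ≡ (if toℕ j <ᵇ toℕ i then 0 else lookup γ j)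
lookup-P i j γ = lookup∘tabulate _ j

lookup-P-≥ : (γ : Term n) → toℕ i ≤ toℕ j → lookup (P i γ) j ≡ lookup γ j
lookup-P-≥ {i = i} {j = j} γ i≤j with toℕ j <ᵇ toℕ i | <ᵇ-reflects-< (toℕ j) (toℕ i) | lookup-P i j γ
... | false | _        | eq = eq
... | true  | ofʸ j<i | _  = contradiction i≤j (<⇒≱ j<i)

lookup-P-< : (γ : Term n) → toℕ j < toℕ i → lookup (P i γ) j ≡ 0
lookup-P-< {j = j} {i = i} γ j<i with toℕ j <ᵇ toℕ i | <ᵇ-reflects-< (toℕ j) (toℕ i) | lookup-P i j γ
... | true  | _        | eq = eq
... | false | ofⁿ j≮i | _  = contradiction j<i j≮i

P-∣ : (i : Fin n) (γ : Term n) → P i γ ∣ₜ γ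
P-∣ i γ j with toℕ j <? toℕ i
... | yes j<i = subst (_≤ lookup γ j) (sym (lookup-P-< γ j<i)) z≤n
... | no  j≮i = ≤-reflexive (lookup-P-≥ γ (≮⇒≥ j≮i))

P≡⇒agree : P i γ ≡ P i δ → AgreeFrom (toℕ i) γ δ
P≡⇒agree {i = i} {γ = γ} {δ = δ} eq = agreeFrom λ j i≤j → begin
  lookup γ j        ≡⟨ lookup-P-≥ γ i≤j ⟨
  lookup (P i γ) j  ≡⟨ cong (λ v → lookup v j) eq ⟩
  lookup (P i δ) j  ≡⟨ lookup-P-≥ δ i≤j ⟩
  lookup δ j        ∎
  where open ≡-Reasoning

agree⇒P≡ : AgreeFrom (toℕ i) γ δ → P i γ ≡ P i δ
agree⇒P≡ {i = i} {γ = γ} {δ = δ} (agreeFrom ag) = Pointwise-≡⇒≡ (ext lookupsAgree)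
  where
  lookupsAgree : ∀ j → lookup (P i γ) j ≡ lookup (P i δ) j
  lookupsAgree j with toℕ j <? toℕ i
  ... | yes j<i = trans (lookup-P-< γ j<i) (sym (lookup-P-< δ j<i))
  ... | no  j≮i = let i≤j = ≮⇒≥ j≮i in
    trans (lookup-P-≥ γ i≤j) (trans (ag j i≤j) (sym (lookup-P-≥ δ i≤j)))

<lex-irrefl : ¬ (γ <lex γ)
<lex-irrefl (_ , γⱼ<γⱼ , _) = <-irrefl refl γⱼ<γⱼ

<lex-trans : γ <lex δ → δ <lex ε → γ <lex ε
<lex-trans {γ = γ} {ε = ε} (j , γⱼ<δⱼ , above) (j′ , δⱼ′<εⱼ′ , above′) with Finₚ.<-cmp j j′
... | tri< j<j′ _ _ = j′ , subst (_< lookup ε j′) (sym (above j′ j<j′)) δⱼ′<εⱼ′ ,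
  λ i j′<i → trans (above i (<-trans j<j′ j′<i)) (above′ i j′<i)
... | tri≈ _ refl _ = j , <-trans γⱼ<δⱼ δⱼ′<εⱼ′ , λ i j<i → trans (above i j<i) (above′ i j<i)
... | tri> _ _ j′<j = j , subst (lookup γ j <_) (above′ j j′<j) γⱼ<δⱼ ,
  λ i j<i → trans (above i j<i) (above′ i (<-trans j′<j j<i))

<lex-convex : γ <lex δ → δ <lex ε → AgreeFrom k γ ε → AgreeFrom k γ δ
<lex-convex {k = k} (j , γⱼ<δⱼ , above) (j′ , δⱼ′<εⱼ′ , above′) γ≈ε with toℕ j <? k
... | yes j<k = agreeFrom λ i k≤i → above i (<-≤-trans j<k k≤i)
... | no  j≮k with Finₚ.<-cmp j j′
...   | tri< j<j′ _ _ =
  contradiction (trans (sym (above j′ j<j′)) (agreeAt γ≈ε j′ (≤-trans (≮⇒≥ j≮k) (<⇒≤ j<j′)))) (<⇒≢ δⱼ′<εⱼ′)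
...   | tri≈ _ refl _ = contradiction (agreeAt γ≈ε j (≮⇒≥ j≮k)) (<⇒≢ (<-trans γⱼ<δⱼ δⱼ′<εⱼ′))
...   | tri> _ _ j′<j = contradiction (trans (agreeAt γ≈ε j (≮⇒≥ j≮k)) (sym (above′ j j′<j))) (<⇒≢ γⱼ<δⱼ)

<lex-at : γ <lex δ → AgreeFrom (suc (toℕ i)) γ δ → ¬ AgreeFrom (toℕ i) γ δ → lookup γ i < lookup δ i
<lex-at {i = i} (j , γⱼ<δⱼ , above) γ≈δ γ≉δ with Finₚ.<-cmp j i
... | tri< j<i _ _ = contradiction (agreeFrom λ l i≤l → above l (<-≤-trans j<i i≤l)) γ≉δ
... | tri≈ _ refl _ = γⱼ<δⱼ
... | tri> _ _ i<j = contradiction (agreeAt γ≈δ j i<j) (<⇒≢ γⱼ<δⱼ)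

starTerm : Fin n → Term n → Term n
starTerm i γ = mulVar i (P i γ)

lookup-starTerm-≡ : (i : Fin n) (γ : Term n) → lookup (starTerm i γ) i ≡ suc (lookup γ i)
lookup-starTerm-≡ i γ = trans (lookup∘updateAt i (P i γ)) (cong suc (lookup-P-≥ γ ≤-refl))

lookup-starTerm-> : (γ : Term n) → toℕ i < toℕ j → lookup (starTerm i γ) j ≡ lookup γ j
lookup-starTerm-> {i = i} {j = j} γ i<j =
  trans (lookup∘updateAt′ j i (<⇒≢ i<j ∘ cong toℕ ∘ sym) (P i γ)) (lookup-P-≥ γ (<⇒≤ i<j))

lookup-starTerm-< : (γ : Term n) → toℕ j < toℕ i → lookup (starTerm i γ) j ≡ 0
lookup-starTerm-< {j = j} {i = i} γ j<i =
  trans (lookup∘updateAt′ j i (<⇒≢ j<i ∘ cong toℕ) (P i γ)) (lookup-P-< γ j<i)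

starTerm-minVar : (i : Fin n) (γ : Term n) → IsMinVar (starTerm i γ) i
starTerm-minVar i γ =
  subst (1 ≤_) (sym (lookup-starTerm-≡ i γ)) (s≤s z≤n) , λ j j<i → lookup-starTerm-< γ j<i

<lex-starTerm : (i : Fin n) (γ : Term n) → γ <lex starTerm i γ
<lex-starTerm i γ = i , subst (lookup γ i <_) (sym (lookup-starTerm-≡ i γ)) (n<1+n _) ,
  λ j i<j → sym (lookup-starTerm-> γ i<j)

agree-starTerm : (i : Fin n) (γ : Term n) → AgreeFrom (suc (toℕ i)) γ (starTerm i γ)
agree-starTerm i γ = agreeFrom λ j i<j → sym (lookup-starTerm-> γ i<j)

divVar-mulVar : (i : Fin n) (γ : Term n) → divVar i (mulVar i γ) ≡ γ
divVar-mulVar i γ = Pointwise-≡⇒≡ (ext lookups)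
  where
  lookups : ∀ j → lookup (divVar i (mulVar i γ)) j ≡ lookup γ j
  lookups j with j Fin.≟ i
  ... | yes refl = trans (lookup∘updateAt i (mulVar i γ)) (cong (_∸ 1) (lookup∘updateAt i γ))
  ... | no  j≢i  = trans (lookup∘updateAt′ j i j≢i (mulVar i γ)) (lookup∘updateAt′ j i j≢i γ)

minVar⇒starTerm : IsMinVar σ i → starTerm i (divVar i σ) ≡ σ
minVar⇒starTerm {σ = σ} {i = i} (1≤σᵢ , belowZero) = Pointwise-≡⇒≡ (ext lookups)
  where
  lookups : ∀ j → lookup (starTerm i (divVar i σ)) j ≡ lookup σ j
  lookups j with Finₚ.<-cmp j i
  ... | tri< j<i _ _ = trans (lookup-starTerm-< (divVar i σ) j<i) (sym (belowZero j j<i))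
  ... | tri≈ _ refl _ = trans (lookup-starTerm-≡ i (divVar i σ))
    (trans (cong suc (lookup∘updateAt i σ)) (m+[n∸m]≡n 1≤σᵢ))
  ... | tri> _ _ i<j = trans (lookup-starTerm-> (divVar i σ) i<j)
    (lookup∘updateAt′ j i (<⇒≢ i<j ∘ cong toℕ ∘ sym) σ)

starTerm-∣ : γ <lex δ → P i γ ≢ P i δ → AgreeFrom (suc (toℕ i)) γ δ → starTerm i γ ∣ₜ δ
starTerm-∣ {γ = γ} {δ = δ} {i = i} γ<δ Pγ≢Pδ γ≈δ j with Finₚ.<-cmp j i
... | tri< j<i _ _ = subst (_≤ lookup δ j) (sym (lookup-starTerm-< γ j<i)) z≤n
... | tri≈ _ refl _ =
  subst (_≤ lookup δ j) (sym (lookup-starTerm-≡ j γ)) (<lex-at γ<δ γ≈δ (Pγ≢Pδ ∘ agree⇒P≡))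
... | tri> _ _ i<j = ≤-reflexive (trans (lookup-starTerm-> γ i<j) (agreeAt γ≈δ j i<j))

starTerm-corner : {L : List (Term n)} → IsOrderIdeal L → γ ∈ L → starTerm i γ ∉ L →
  CornerSet L (starTerm i γ)
starTerm-corner {γ = γ} {i = i} ideal γ∈L σ∉L = σ∉L , i , starTerm-minVar i γ ,
  subst (_∈ _) (sym (divVar-mulVar i (P i γ))) (ideal γ (P i γ) (P-∣ i γ) γ∈L)

lookup-<-linked : ∀ {a ℓ} {A : Set a} {R : Rel A ℓ} {xs : List A} → Transitive R → Linked R xs →
  ∀ {c d} → c Fin.< d → R (List.lookup xs c) (List.lookup xs d)
lookup-<-linked {xs = _ ∷ _} tr xs↗ {Fin.zero}  {Fin.suc d} _ =
  Linked.lookup tr (Linked.tail xs↗) (Linked.head′ xs↗) d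
lookup-<-linked {xs = _ ∷ _} tr xs↗ {Fin.suc c} {Fin.suc d} c<d =
  lookup-<-linked tr (Linked.tail xs↗) (s≤s⁻¹ c<d)

-- For f = row i, IsRun is BarCode.IsBar i, definitionally.
module Runs {b} {B : Set b} (_≟_ : DecidableEquality B) {M : ℕ} (f : Fin M → B) where

  InRange : Fin M → Fin M → Fin M → Set
  InRange x a e = toℕ a ≤ toℕ x × toℕ x ≤ toℕ e

  ConstantOn : Fin M → Fin M → Set b
  ConstantOn a e = ∀ x → toℕ a ≤ toℕ x → toℕ x ≤ toℕ e → f x ≡ f a

  StartsRun : Fin M → Set b
  StartsRun a = ∀ d → suc (toℕ d) ≡ toℕ a → f d ≢ f a

  EndsRun : Fin M → Set b
  EndsRun e = ∀ d → toℕ d ≡ suc (toℕ e) → f d ≢ f e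

  IsRun : Fin M → Fin M → Set b
  IsRun a e = toℕ a ≤ toℕ e × ConstantOn a e × StartsRun a × EndsRun e

  private
    constant-singleton : ∀ c → ConstantOn c c
    constant-singleton c x c≤x x≤c = cong f (toℕ-injective (≤-antisym x≤c c≤x))

    RightEnd : Fin M → Fin M → Set b
    RightEnd c e = toℕ c ≤ toℕ e × ConstantOn c e × EndsRun e

    LeftEnd : Fin M → Fin M → Set b
    LeftEnd c a = toℕ a ≤ toℕ c × (∀ x → toℕ a ≤ toℕ x → toℕ x ≤ toℕ c → f x ≡ f c) × StartsRun a

    rightEnd : ∀ k (c : Fin M) → M ∸ suc (toℕ c) ≡ k → ∃ (RightEnd c)
    rightEnd zero c noneAfter = c , ≤-refl , constant-singleton c ,
      λ d d≡ → contradiction (<-≤-trans (toℕ<n d) (m∸n≡0⇒m≤n noneAfter)) (<-irrefl d≡)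
    rightEnd (suc k) c someAfter = extend (f c′ ≟ f c)
      where
      c<M : suc (toℕ c) < M
      c<M = m∸n≢0⇒n<m λ none → 1+n≢0 (trans (sym someAfter) none)
      c′ : Fin M
      c′ = fromℕ< c<M
      c′≡ : toℕ c′ ≡ suc (toℕ c)
      c′≡ = toℕ-fromℕ< c<M
      rest : M ∸ suc (toℕ c′) ≡ k
      rest = begin
        M ∸ suc (toℕ c′)         ≡⟨ cong (λ x → M ∸ suc x) c′≡ ⟩
        M ∸ suc (suc (toℕ c))    ≡⟨ pred[m∸n]≡m∸[1+n] M (suc (toℕ c)) ⟨
        pred (M ∸ suc (toℕ c))   ≡⟨ cong pred someAfter ⟩
        k                        ∎
        where open ≡-Reasoning
      extend : Dec (f c′ ≡ f c) → ∃ (RightEnd c)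
      extend (no fc′≢fc) = c , ≤-refl , constant-singleton c ,
        λ d d≡ fd≡fc → fc′≢fc (subst (λ x → f x ≡ f c) (toℕ-injective (trans d≡ (sym c′≡))) fd≡fc)
      extend (yes fc′≡fc) with rightEnd k c′ rest
      ... | e , c′≤e , constant , endsRun =
        e , ≤-trans (n≤1+n _) (subst (_≤ toℕ e) c′≡ c′≤e) , constant′ , endsRun
        where
        constant′ : ConstantOn c e
        constant′ x c≤x x≤e with m≤n⇒m<n∨m≡n c≤x
        ... | inj₁ c<x = trans (constant x (subst (_≤ toℕ x) (sym c′≡) c<x) x≤e) fc′≡fc
        ... | inj₂ c≡x = cong f (toℕ-injective (sym c≡x))

    leftEnd : ∀ k (c : Fin M) → toℕ c ≡ k → ∃ (LeftEnd c)
    leftEnd zero c c≡0 =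
      c , ≤-refl , constant-singleton c , λ d d≡ → contradiction (trans d≡ c≡0) 1+n≢0
    leftEnd (suc k) c c≡ = extend (f c′ ≟ f c)
      where
      k<M : k < M
      k<M = <-trans (n<1+n k) (subst (_< M) c≡ (toℕ<n c))
      c′ : Fin M
      c′ = fromℕ< k<M
      c′≡ : toℕ c′ ≡ k
      c′≡ = toℕ-fromℕ< k<M
      extend : Dec (f c′ ≡ f c) → ∃ (LeftEnd c)
      extend (no fc′≢fc) = c , ≤-refl , constant-singleton c ,
        λ d d≡ fd≡fc → fc′≢fc (subst (λ x → f x ≡ f c) (toℕ-injective (trans (suc-injective (trans d≡ c≡)) (sym c′≡)))
          fd≡fc)
      extend (yes fc′≡fc) with leftEnd k c′ c′≡
      ... | a , a≤c′ , constant , startsRun = a , a≤c , constant′ , startsRun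
        where
        a≤c : toℕ a ≤ toℕ c
        a≤c = ≤-trans a≤c′ (subst (toℕ c′ ≤_) (sym c≡) (≤-trans (≤-reflexive c′≡) (n≤1+n k)))
        constant′ : ∀ x → toℕ a ≤ toℕ x → toℕ x ≤ toℕ c → f x ≡ f c
        constant′ x a≤x x≤c with m≤n⇒m<n∨m≡n x≤c
        ... | inj₁ x<c = trans (constant x a≤x (subst (toℕ x ≤_) (sym c′≡) (s≤s⁻¹ (subst (suc (toℕ x) ≤_) c≡ x<c))))
          fc′≡fc
        ... | inj₂ x≡c = cong f (toℕ-injective x≡c)

  runFrom : (a : Fin M) → StartsRun a → ∃ (IsRun a)
  runFrom a startsRun with rightEnd _ a refl
  ... | e , a≤e , constant , endsRun = e , a≤e , constant , startsRun , endsRun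

  runAround : (c : Fin M) → ∃₂ λ a e → IsRun a e × InRange c a e
  runAround c with leftEnd _ c refl | rightEnd _ c refl
  ... | a , a≤c , constantˡ , startsRun | e , c≤e , constantʳ , endsRun =
    a , e , (≤-trans a≤c c≤e , constant , startsRun , endsRun) , (a≤c , c≤e)
    where
    fa≡fc : f a ≡ f c
    fa≡fc = constantˡ a ≤-refl a≤c
    constant : ConstantOn a e
    constant x a≤x x≤e with toℕ x ≤? toℕ c
    ... | yes x≤c = trans (constantˡ x a≤x x≤c) (sym fa≡fc)
    ... | no  x≰c = trans (constantʳ x (<⇒≤ (≰⇒> x≰c)) x≤e) (sym fa≡fc)

  run-maximal : ∀ {a e c y} → IsRun a e → InRange c a e → toℕ c ≤ toℕ y →
    ConstantOn c y → toℕ y ≤ toℕ e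
  run-maximal {a} {e} {c} {y} (a≤e , constant , _ , endsRun) (a≤c , c≤e) c≤y constantTo-y
    with toℕ y ≤? toℕ e
  ... | yes y≤e = y≤e
  ... | no  y≰e = contradiction fd≡fe (endsRun d d≡)
    where
    e<y : suc (toℕ e) ≤ toℕ y
    e<y = ≰⇒> y≰e
    e<M : suc (toℕ e) < M
    e<M = ≤-<-trans e<y (toℕ<n y)
    d : Fin M
    d = fromℕ< e<M
    d≡ : toℕ d ≡ suc (toℕ e)
    d≡ = toℕ-fromℕ< e<M
    fd≡fe : f d ≡ f e
    fd≡fe = begin
      f d  ≡⟨ constantTo-y d (≤-trans c≤e (subst (toℕ e ≤_) (sym d≡) (n≤1+n _)))
                             (subst (_≤ toℕ y) (sym d≡) e<y) ⟩
      f c  ≡⟨ constant c a≤c c≤e ⟩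
      f a  ≡⟨ constant e a≤e ≤-refl ⟨
      f e  ∎
      where open ≡-Reasoning

_≟ₜ_ : DecidableEquality (Term n)
_≟ₜ_ = ≡-dec _≟_

module _ {n} (L : List (Term n)) (L↗ : Linked _<lex_ L) where
  open BarCode L

  private variable
    a b b′ c d e x y z : Fin m

  τ-<lex : c Fin.< d → τ c <lex τ d
  τ-<lex = lookup-<-linked (λ {γ δ ε} → <lex-trans {γ = γ} {δ} {ε}) L↗

  τ-agree-convex : toℕ x ≤ toℕ y → toℕ y ≤ toℕ z → AgreeFrom k (τ x) (τ z) → AgreeFrom k (τ x) (τ y)
  τ-agree-convex {x = x} {y = y} {z = z} x≤y y≤z τx≈τz with m≤n⇒m<n∨m≡n x≤y | m≤n⇒m<n∨m≡n y≤z
  ... | inj₂ x≡y | _        rewrite toℕ-injective x≡y = agreeFrom λ _ _ → refl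
  ... | inj₁ _   | inj₂ y≡z rewrite toℕ-injective y≡z = τx≈τz
  ... | inj₁ x<y | inj₁ y<z = <lex-convex (τ-<lex x<y) (τ-<lex y<z) τx≈τz

  column : {ρ : Term n} → ρ ∈ L → ∃ λ c → τ c ≡ ρ
  column ρ∈L = index ρ∈L , sym (lookup-index ρ∈L)

  bar-agree : {i : Fin n} → IsBar i a b → InInterval x a b → InInterval y a b → AgreeFrom (toℕ i) (τ x) (τ y)
  bar-agree (_ , constant , _) (a≤x , x≤b) (a≤y , y≤b) =
    P≡⇒agree (trans (constant _ a≤x x≤b) (sym (constant _ a≤y y≤b)))

  bar-around : (i : Fin n) (c : Fin m) → ∃₂ λ a b → IsBar i a b × InInterval c a b
  bar-around i = Runs.runAround _≟ₜ_ (row i)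

  nextBar : {i : Fin n} → IsBar i a b → (b<m : suc (toℕ b) < m) → ∃ (IsBar i (fromℕ< b<m))
  nextBar {b = b} {i = i} (_ , _ , _ , endsBar) b<m = Runs.runFrom _≟ₜ_ (row i) (fromℕ< b<m) startsBar
    where
    startsBar : ∀ d → suc (toℕ d) ≡ toℕ (fromℕ< b<m) → row i d ≢ row i (fromℕ< b<m)
    startsBar d d≡ with toℕ-injective {i = d} {j = b} (suc-injective (trans d≡ (toℕ-fromℕ< b<m)))
    ... | refl = endsBar (fromℕ< b<m) (toℕ-fromℕ< b<m) ∘ sym

  agree⇒sameBar : {i : Fin n} → toℕ a ≤ toℕ e → AgreeFrom (toℕ i) (τ a) (τ e) →
    ∃₂ λ a₂ b₂ → IsBar i a₂ b₂ × InInterval a a₂ b₂ × InInterval e a₂ b₂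
  agree⇒sameBar {a = a} {e = e} {i = i} a≤e τa≈τe with bar-around i a
  ... | a₂ , b₂ , bar , a∈@(a₂≤a , _) = a₂ , b₂ , bar , a∈ , (≤-trans a₂≤a a≤e , e≤b₂)
    where
    e≤b₂ : toℕ e ≤ toℕ b₂
    e≤b₂ = Runs.run-maximal _≟ₜ_ (row i) bar a∈ a≤e
      λ x a≤x x≤e → agree⇒P≡ (agree-sym (τ-agree-convex a≤x x≤e τa≈τe))

  starTerm-beyond-bar : {i : Fin n} → IsBar i a b → InInterval c a b → τ d ≡ starTerm i (τ c) → toℕ b < toℕ d
  starTerm-beyond-bar {a = a} {b = b} {c = c} {d = d} {i = i} bar c∈@(a≤c , _) τd≡ with toℕ a ≤? toℕ d
  ... | no  a≰d = contradiction τd<τd (<lex-irrefl {γ = τ d})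
    where
    τd<τd : τ d <lex τ d
    τd<τd = <lex-trans {γ = τ d} {τ c} {τ d} (τ-<lex (<-≤-trans (≰⇒> a≰d) a≤c))
      (subst (τ c <lex_) (sym τd≡) (<lex-starTerm i (τ c)))
  ... | yes a≤d with toℕ d ≤? toℕ b
  ...   | no  d≰b = ≰⇒> d≰b
  ...   | yes d≤b = contradiction (begin
    lookup (τ c) i             ≡⟨ agreeAt (bar-agree bar (a≤d , d≤b) c∈) i ≤-refl ⟨
    lookup (τ d) i             ≡⟨ cong (λ v → lookup v i) τd≡ ⟩
    lookup (starTerm i (τ c)) i ≡⟨ lookup-starTerm-≡ i (τ c) ⟩
    suc (lookup (τ c) i)       ∎) (<⇒≢ (n<1+n _))
    where open ≡-Reasoning

  starTerm-∉-ruleA : {i : Fin n} → IsBar i a b → suc (toℕ b) ≡ m → InInterval c a b → starTerm i (τ c) ∉ L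
  starTerm-∉-ruleA bar last c∈ σ∈L with column σ∈L
  ... | d , τd≡ =
    <⇒≱ (starTerm-beyond-bar bar c∈ τd≡) (s≤s⁻¹ (subst (toℕ d <_) (sym last) (toℕ<n d)))

  starTerm-∉-ruleB : {i : Fin n} → IsBar i a b → IsBar i b′ e → toℕ b′ ≡ suc (toℕ b) → InInterval c a b →
    ¬ AgreeFrom (suc (toℕ i)) (τ c) (τ e) → starTerm i (τ c) ∉ L
  starTerm-∉-ruleB {b = b} {b′ = b′} {e = e} {c = c} {i = i} bar bar′@(b′≤e , _) b′≡ c∈@(_ , c≤b) τc≉τe σ∈L
    with column σ∈L
  ... | d , τd≡ = τc≉τe τc≈τe
    where
    τc≈τd : AgreeFrom (suc (toℕ i)) (τ c) (τ d)
    τc≈τd = subst (AgreeFrom (suc (toℕ i)) (τ c)) (sym τd≡) (agree-starTerm i (τ c))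
    τc≈τe : AgreeFrom (suc (toℕ i)) (τ c) (τ e)
    τc≈τe with toℕ e ≤? toℕ d
    ... | yes e≤d = τ-agree-convex (<⇒≤ (≤-<-trans c≤b (subst (_≤ toℕ e) b′≡ b′≤e))) e≤d τc≈τd
    ... | no  e≰d = agree-trans τc≈τd (agree-weaken (n≤1+n _) (bar-agree bar′ d∈ (b′≤e , ≤-refl)))
      where
      d∈ : InInterval d b′ e
      d∈ = subst (_≤ toℕ d) (sym b′≡) (starTerm-beyond-bar bar c∈ τd≡) , <⇒≤ (≰⇒> e≰d)

  starTerm-∣-nextBar : {i : Fin n} → IsBar i a b → IsBar i b′ e → toℕ b′ ≡ suc (toℕ b) → InInterval c a b →
    AgreeFrom (suc (toℕ i)) (τ c) (τ e) → starTerm i (τ c) ∣ₜ τ e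
  starTerm-∣-nextBar {a = a} {b = b} {b′ = b′} {e = e} {c = c} {i = i}
    (a≤b , constant , _ , endsBar) (b′≤e , constant′ , _) b′≡ (a≤c , c≤b) =
    starTerm-∣ {i = i} (τ-<lex c<e) Pτc≢Pτe
    where
    c<e : toℕ c < toℕ e
    c<e = ≤-<-trans c≤b (subst (_≤ toℕ e) b′≡ b′≤e)
    Pτc≢Pτe : row i c ≢ row i e
    Pτc≢Pτe rowc≡rowe = endsBar b′ b′≡ (begin
      row i b′  ≡⟨ constant′ e b′≤e ≤-refl ⟨
      row i e   ≡⟨ rowc≡rowe ⟨
      row i c   ≡⟨ constant c a≤c c≤b ⟩
      row i a   ≡⟨ constant b a≤b ≤-refl ⟨
      row i b   ∎)
      where open ≡-Reasoning

  starSet⇒corner : IsOrderIdeal L → StarSet σ → CornerSet L σ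
  starSet⇒corner ideal (inj₁ (i , a , b , c , bar , last , c∈ , refl)) =
    starTerm-corner ideal (∈-lookup c) (starTerm-∉-ruleA bar last c∈)
  starSet⇒corner ideal
    (inj₂ (i , i′ , i′≡ , a , b , b′ , e , bar , bar′ , b′≡ , separated , c , c∈ , refl)) =
    starTerm-corner ideal (∈-lookup c) (starTerm-∉-ruleB bar bar′ b′≡ c∈ τc≉τe)
    where
    a≤e : toℕ a ≤ toℕ e
    a≤e = ≤-trans (proj₁ bar) (≤-trans (n≤1+n _) (subst (_≤ toℕ e) b′≡ (proj₁ bar′)))
    τc≉τe : ¬ AgreeFrom (suc (toℕ i)) (τ c) (τ e)
    τc≉τe τc≈τe = separated (agree⇒sameBar a≤e (subst (λ k → AgreeFrom k (τ a) (τ e)) (sym i′≡)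
      (agree-trans (agree-weaken (n≤1+n _) (bar-agree bar (≤-refl , proj₁ bar) c∈)) τc≈τe)))

  starTerm-ruleB : {i : Fin n} → IsBar i a b → IsBar i b′ e → toℕ b′ ≡ suc (toℕ b) → InInterval c a b →
    ¬ AgreeFrom (suc (toℕ i)) (τ c) (τ e) → StarSet (starTerm i (τ c))
  starTerm-ruleB {a = a} {b = b} {b′ = b′} {e = e} {c = c} {i} bar bar′ b′≡ c∈ τc≉τe with suc (toℕ i) <? n
  ... | no  i+1≮n = contradiction (agreeFrom λ j i<j → contradiction (≤-<-trans i<j (toℕ<n j)) i+1≮n) τc≉τe
  ... | yes i+1<n =
    inj₂ (i , fromℕ< i+1<n , toℕ-fromℕ< i+1<n , a , b , b′ , e , bar , bar′ , b′≡ , separated , c , c∈ , refl)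
    where
    separated : ¬ (∃₂ λ a₂ b₂ → IsBar (fromℕ< i+1<n) a₂ b₂ × InInterval a a₂ b₂ × InInterval e a₂ b₂)
    separated (_ , _ , bar₂ , a∈ , e∈) = τc≉τe (agree-trans
      (agree-weaken (n≤1+n _) (bar-agree bar c∈ (≤-refl , proj₁ bar)))
      (subst (λ k → AgreeFrom k (τ a) (τ e)) (toℕ-fromℕ< i+1<n) (bar-agree bar₂ a∈ e∈)))

  starTerm-starSet : IsOrderIdeal L → {i : Fin n} → IsBar i a b → InInterval c a b → starTerm i (τ c) ∉ L →
    StarSet (starTerm i (τ c))
  starTerm-starSet {b = b} ideal {i} bar c∈ σ∉L with suc (toℕ b) ≟ m
  ... | yes last = inj₁ (i , _ , b , _ , bar , last , c∈ , refl)
  ... | no  notLast with ≤∧≢⇒< (toℕ<n b) notLast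
  ...   | b<m with nextBar {i = i} bar b<m
  ...     | e , bar′ = starTerm-ruleB {i = i} bar bar′ (toℕ-fromℕ< b<m) c∈ λ τc≈τe →
    σ∉L (ideal (τ e) _ (starTerm-∣-nextBar {i = i} bar bar′ (toℕ-fromℕ< b<m) c∈ τc≈τe) (∈-lookup e))

  corner⇒starSet : IsOrderIdeal L → CornerSet L σ → StarSet σ
  corner⇒starSet {σ = σ} ideal (σ∉L , i , σ-minVar , σ/xᵢ∈L) with column σ/xᵢ∈L
  ... | c , τc≡ with bar-around i c
  ...   | _ , _ , bar , c∈ =
    subst StarSet τc↦σ (starTerm-starSet ideal bar c∈ (σ∉L ∘ subst (_∈ L) τc↦σ))
    where
    τc↦σ : starTerm i (τ c) ≡ σ
    τc↦σ = trans (cong (starTerm i) τc≡) (minVar⇒starTerm σ-minVar)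

mainTheorem3 : (n : ℕ) (L : List (Term n)) → Linked _<lex_ L → IsOrderIdeal L →
    (σ : Term n) → (BarCode.StarSet L σ → CornerSet L σ) × (CornerSet L σ → BarCode.StarSet L σ)
mainTheorem3 n L L↗ ideal σ = starSet⇒corner L L↗ ideal , corner⇒starSet L L↗ ideal
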